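{- Let $m \geq 4$ be an integer, $q$ a prime power, $n$ a positive integer with $m \le n+2$, and $k = \lfloor m/2 \rfloor$. If $A$ is an $m$-general set in $\mathbb{F}_q^n$, then \[ |A| \leq \frac{k\, q^{n/k}}{(q-1)^{1-2/k}(q-2)^{1/k}} \quad \text{if } q > 2, \] and \[ |A| \leq (k!)^{1/k}\, 2^{n/k} + k \quad \text{if } q = 2. \]
   Context: A set $A \subseteq \mathbb{F}_q^n$ with $|A| \ge m$ is called $m$-general (for $3 \le m \le n+2$) if no $m$ points of $A$ lie on a single $(m-2)$-dimensional affine subspace (flat) of $\mathbb{F}_q^n$; equivalently, every $m$-element subset of $A$ is affinely independent (a set of points is affinely dependent if there is a linear combination $\sum_j c_j \mathbf{a}_j = \mathbf{0}$ with $\sum_j c_j = 0$ and the $c_j$ not all zero). -}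

module Defs where

open import Level using (0ℓ)
open import Data.Nat using (ℕ; zero; suc; _^_; _≤_)
open import Data.Nat.Primality using (Prime)
open import Data.Fin using (Fin)
open import Data.Product using (Σ; ∃; _×_)
open import Relation.Binary.PropositionalEquality using (_≡_)
open import Relation.Nullary using (¬_)
open import Function.Definitions using (Injective)
open import Algebra.Structures using (IsCommutativeRing)

IsPrimePower : ℕ → Set
IsPrimePower q = Σ ℕ λ p → Σ ℕ λ r → Prime p × 1 ≤ r × q ≡ p ^ r

-- A field structure whose carrier is Fin q (with propositional equality).
-- Every finite field with q elements is isomorphic to one of these,
-- so "F_q" is modelled as an arbitrary such structure.
record FieldOn (q : ℕ) : Set where
  field
    _+_ _*_ : Fin q → Fin q → Fin q
    -_      : Fin q → Fin q
    0# 1#   : Fin q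
    isCommutativeRing : IsCommutativeRing _≡_ _+_ _*_ -_ 0# 1#
    0≢1     : ¬ (0# ≡ 1#)
    inverse : ∀ x → ¬ (x ≡ 0#) → ∃ λ y → x * y ≡ 1#

Point : ℕ → ℕ → Set
Point q n = Fin n → Fin q

module _ {q : ℕ} (F : FieldOn q) where
  open FieldOn F

  ∑ : ∀ {m} → (Fin m → Fin q) → Fin q
  ∑ {zero}  f = 0#
  ∑ {suc m} f = f Fin.zero + ∑ (λ j → f (Fin.suc j))

  AffinelyIndependent : ∀ {n m} → (Fin m → Point q n) → Set
  AffinelyIndependent {n} {m} a =
    (c : Fin m → Fin q) →
    ∑ c ≡ 0# →
    (∀ (i : Fin n) → ∑ (λ j → c j * a j i) ≡ 0#) →
    ∀ j → c j ≡ 0#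

  -- A set A ⊆ F_q^n of size N, given as an injective enumeration a : Fin N → F_q^n,
  -- is m-general: |A| ≥ m and every m-element subset (m distinct points) is
  -- affinely independent.
  IsGeneral : ∀ {n N} → ℕ → (Fin N → Point q n) → Set
  IsGeneral {n} {N} m a =
    m ≤ N × ((s : Fin m → Fin N) → Injective _≡_ _≡_ s → AffinelyIndependent (λ j → a (s j)))

module Submission where

open import Defs
open import Data.Nat using (ℕ; _≤_; _<_; _+_; _*_; _∸_; _^_; _/_; _!)
open import Data.Fin using (Fin)
open import Data.Product using (_×_)
open import Relation.Binary.PropositionalEquality using (_≡_)
open import Function.Definitions using (Injective)

open import Level using (0ℓ)
open import Data.Nat using (zero; suc; z≤n; s≤s)
open import Data.Nat.Properties
  using ( ≤-refl; ≤-trans; ≤-reflexive; ≤-antisym; <⇒≤; ≰⇒>; _≤?_; n≤1+n; module ≤-Reasoning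
        ; +-suc; +-mono-≤; +-monoˡ-≤; +-cancelˡ-≤; m∸n+n≡m; m≤n⇒m∸n≡0; ∸-monoʳ-≤
        ; *-comm; *-assoc; *-suc; *-zeroʳ; *-identityˡ; *-identityʳ
        ; *-mono-≤; *-monoˡ-≤; *-monoʳ-≤; *-cancelˡ-≤; *-cancelʳ-≤
        ; ^-monoˡ-≤; ^-distribˡ-+-*; ^-zeroˡ; _!≢0; +-identityʳ; m≤m+n)
open import Data.Nat.DivMod using (m/n*n≤m; /-monoˡ-≤)
open import Data.Nat.Combinatorics.Base using (_P′_)
open import Data.Nat.Combinatorics.Specification using (nP′k≡n[n∸1P′k∸1])
open import Data.Nat.Tactic.RingSolver using (solve-∀)
open import Data.Bool using (if_then_else_)
open import Data.Fin using (zero; suc; join; splitAt; combine; remQuot; punchIn; funToFin; finToFun)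
open import Data.Fin.Properties
  using (join-splitAt; combine-remQuot; finToFun-funToFin; injective⇒≤; punchIn-injective; punchInᵢ≢i)
  renaming (_≟_ to _≟ᶠ_; suc-injective to sucᶠ-injective)
open import Data.Vec.Functional using (Vector; _∷_; _++_; concat; map; tail)
open import Data.Vec.Functional.Relation.Unary.All.Properties using (++⁺)
open import Data.Product using (Σ; _,_; proj₁; proj₂)
open import Data.Sum using (inj₁; inj₂; [_,_])
open import Data.Unit using (⊤; tt)
open import Data.Empty using (⊥-elim)
open import Function using (_∘_)
open import Relation.Binary.PropositionalEquality
  using (refl; sym; trans; cong; cong₂; _≗_; module ≡-Reasoning)
open import Relation.Nullary using (¬_; yes; no; does)
open import Algebra.Bundles using (CommutativeRing)
import Algebra.Properties.Semiring.Sum as SemiringSum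
import Algebra.Properties.Ring as RingProperties
import Algebra.Properties.Monoid.Mult as MonoidMult
import Algebra.Properties.AbelianGroup as AbelianGroupProperties

-- Let a_0,…,a_{N-1} be an m-general family in F_q^n and k = ⌊m/2⌋.  The
-- syndrome of d ∈ F_q^N is (∑ d_j , ∑ d_j a_j) ∈ F_q^(1+n).  A nonzero d with at
-- most m nonzero entries has nonzero syndrome, since its support lies within m
-- of the points and these are affinely independent.  So two vectors with at
-- most k nonzero entries (their difference has at most 2k ≤ m) are equal as
-- soon as their syndromes are.  Consequently the C(N,k)(q-1)^k vectors with
-- exactly k nonzero entries inject into F_q^(1+n), and the C(N,k) 0/1-vectors
-- with k ones, whose syndromes all start with k·1, inject into F_q^n.  The
-- bounds follow by arithmetic: N^k ≤ k^k C(N,k), (N-k)^k ≤ k! C(N,k), and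
-- q(q-2) ≤ (q-1)².

-- The number C(N,k)·r^k of vectors of length N with exactly k nonzero
-- entries, each taken from r possible nonzero values (Pascal's recursion on
-- whether the first entry is zero).
weightCount : ℕ → ℕ → ℕ → ℕ
weightCount r N       zero    = 1
weightCount r zero    (suc k) = 0
weightCount r (suc N) (suc k) = weightCount r N (suc k) + r * weightCount r N k

P′-suc : ∀ N k → suc N P′ suc k ≡ suc N * (N P′ k)
P′-suc N k = nP′k≡n[n∸1P′k∸1] (suc N) (suc k)

P′-vanishes : ∀ {N k} → N < k → N P′ k ≡ 0
P′-vanishes {N} {suc k} (s≤s N≤k) = cong (_* (N P′ k)) (m≤n⇒m∸n≡0 N≤k)

P′-telescope : ∀ N k → (N ∸ k + suc k) * (N P′ k) ≡ suc N * (N P′ k)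
P′-telescope N k with k ≤? N
... | yes k≤N = cong (_* (N P′ k)) (trans (+-suc (N ∸ k) k) (cong suc (m∸n+n≡m k≤N)))
... | no k≰N = begin
  (N ∸ k + suc k) * (N P′ k)  ≡⟨ cong ((N ∸ k + suc k) *_) vanishes ⟩
  (N ∸ k + suc k) * 0         ≡⟨ *-zeroʳ (N ∸ k + suc k) ⟩
  0                           ≡⟨ *-zeroʳ (suc N) ⟨
  suc N * 0                   ≡⟨ cong (suc N *_) vanishes ⟨
  suc N * (N P′ k)            ∎
  where
  open ≡-Reasoning
  vanishes : N P′ k ≡ 0
  vanishes = P′-vanishes (≰⇒> k≰N)

weightCount-P′ : ∀ r N k → weightCount r N k * k ! ≡ r ^ k * (N P′ k)
weightCount-P′ r N       zero    = refl
weightCount-P′ r zero    (suc k) =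
  sym (trans (cong (r ^ suc k *_) (P′-vanishes {0} {suc k} (s≤s z≤n))) (*-zeroʳ (r ^ suc k)))
weightCount-P′ r (suc N) (suc k) = begin
  (c₁ + r * c₀) * (suc k * k !)
    ≡⟨ expand c₁ r c₀ (suc k) (k !) ⟩
  c₁ * (suc k * k !) + r * suc k * (c₀ * k !)
    ≡⟨ cong₂ (λ x y → x + r * suc k * y) (weightCount-P′ r N (suc k)) (weightCount-P′ r N k) ⟩
  r * r ^ k * ((N ∸ k) * f) + r * suc k * (r ^ k * f)
    ≡⟨ collect r (r ^ k) (N ∸ k) (suc k) f ⟩
  r * r ^ k * ((N ∸ k + suc k) * f)
    ≡⟨ cong (r * r ^ k *_) (trans (P′-telescope N k) (sym (P′-suc N k))) ⟩
  r * r ^ k * (suc N P′ suc k)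
    ∎
  where
  open ≡-Reasoning
  c₁ c₀ f : ℕ
  c₁ = weightCount r N (suc k)
  c₀ = weightCount r N k
  f = N P′ k
  expand : ∀ c₁ r c₀ s g → (c₁ + r * c₀) * (s * g) ≡ c₁ * (s * g) + r * s * (c₀ * g)
  expand = solve-∀
  collect : ∀ r p d s f → r * p * (d * f) + r * s * (p * f) ≡ r * p * ((d + s) * f)
  collect = solve-∀

-- Each of the k factors of N(N-1)…(N-k+1) is at least N - k.
P′-lower : ∀ N k → (N ∸ k) ^ k ≤ N P′ k
P′-lower N zero    = ≤-refl
P′-lower N (suc k) = *-mono-≤ shrink (≤-trans (^-monoˡ-≤ k shrink) (P′-lower N k))
  where
  shrink : N ∸ suc k ≤ N ∸ k
  shrink = ∸-monoʳ-≤ N (n≤1+n k)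

-- If A/B ≤ N/k and B ≤ A then every ratio (N-i)/(k-i) is at least A/B, so
-- (A/B)^k ≤ N(N-1)…(N-k+1)/k!.
P′-upper : ∀ N k A B → B ≤ A → A * k ≤ B * N → A ^ k * k ! ≤ B ^ k * (N P′ k)
P′-upper N       zero    A       B B≤A Ak≤BN = ≤-refl
P′-upper zero    (suc k) zero    B B≤A Ak≤BN = z≤n
P′-upper zero    (suc k) (suc A) B B≤A Ak≤BN with ≤-trans Ak≤BN (≤-reflexive (*-zeroʳ B))
... | ()
P′-upper (suc N) (suc k) A       B B≤A Ak≤BN = begin
  A * A ^ k * (suc k * k !)       ≡⟨ regroup A (A ^ k) (suc k) (k !) ⟩
  A * suc k * (A ^ k * k !)       ≤⟨ *-mono-≤ Ak≤BN (P′-upper N k A B B≤A ratio) ⟩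
  B * suc N * (B ^ k * (N P′ k))  ≡⟨ regroup B (B ^ k) (suc N) (N P′ k) ⟨
  B * B ^ k * (suc N * (N P′ k))  ≡⟨ cong (B * B ^ k *_) (P′-suc N k) ⟨
  B * B ^ k * (suc N P′ suc k)    ∎
  where
  open ≤-Reasoning
  regroup : ∀ a p s f → a * p * (s * f) ≡ a * s * (p * f)
  regroup = solve-∀
  ratio : A * k ≤ B * N
  ratio = +-cancelˡ-≤ A (A * k) (B * N) (begin
    A + A * k  ≡⟨ *-suc A k ⟨
    A * suc k  ≤⟨ Ak≤BN ⟩
    B * suc N  ≡⟨ *-suc B N ⟩
    B + B * N  ≤⟨ +-monoˡ-≤ (B * N) B≤A ⟩
    A + B * N  ∎)

count⇒scaledBound : ∀ r N k M → k ≤ N → weightCount r N k ≤ M → r ^ k * N ^ k ≤ k ^ k * M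
count⇒scaledBound r N k M k≤N count≤M = *-cancelʳ-≤ (r ^ k * N ^ k) (k ^ k * M) (k !) (begin
  r ^ k * N ^ k * k !             ≡⟨ *-assoc (r ^ k) (N ^ k) (k !) ⟩
  r ^ k * (N ^ k * k !)           ≤⟨ *-monoʳ-≤ (r ^ k) (P′-upper N k N k k≤N (≤-reflexive (*-comm N k))) ⟩
  r ^ k * (k ^ k * (N P′ k))      ≡⟨ swap (r ^ k) (k ^ k) (N P′ k) ⟩
  k ^ k * (r ^ k * (N P′ k))      ≡⟨ cong (k ^ k *_) (weightCount-P′ r N k) ⟨
  k ^ k * (weightCount r N k * k !) ≤⟨ *-monoʳ-≤ (k ^ k) (*-monoˡ-≤ (k !) count≤M) ⟩
  k ^ k * (M * k !)               ≡⟨ *-assoc (k ^ k) M (k !) ⟨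
  k ^ k * M * k !                 ∎)
  where
  open ≤-Reasoning
  instance _ = k !≢0
  swap : ∀ a b c → a * (b * c) ≡ b * (a * c)
  swap = solve-∀

count⇒shiftedBound : ∀ r N k M → weightCount r N k ≤ M → r ^ k * (N ∸ k) ^ k ≤ k ! * M
count⇒shiftedBound r N k M count≤M = begin
  r ^ k * (N ∸ k) ^ k           ≤⟨ *-monoʳ-≤ (r ^ k) (P′-lower N k) ⟩
  r ^ k * (N P′ k)              ≡⟨ weightCount-P′ r N k ⟨
  weightCount r N k * k !       ≤⟨ *-monoˡ-≤ (k !) count≤M ⟩
  M * k !                       ≡⟨ *-comm M (k !) ⟩
  k ! * M                       ∎
  where open ≤-Reasoning

-- With q = s + 2: since q(q-2) ≤ (q-1)², the bound (q-1)^k N^k ≤ k^k·q·M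
-- yields N^k (q-1)^(k-2) (q-2) ≤ k^k·M.
trade-q-for-q-2 : ∀ s N k M → 2 ≤ k → suc s ^ k * N ^ k ≤ k ^ k * (suc (suc s) * M) →
  N ^ k * suc s ^ (k ∸ 2) * s ≤ k ^ k * M
trade-q-for-q-2 s N k M 2≤k bound = *-cancelˡ-≤ q (begin
  q * (N ^ k * r ^ (k ∸ 2) * s)     ≡⟨ regroup q (N ^ k) (r ^ (k ∸ 2)) s ⟩
  N ^ k * (r ^ (k ∸ 2) * (q * s))   ≤⟨ *-monoʳ-≤ (N ^ k) (*-monoʳ-≤ (r ^ (k ∸ 2)) q[q-2]≤[q-1]²) ⟩
  N ^ k * (r ^ (k ∸ 2) * r ^ 2)     ≡⟨ cong (N ^ k *_) (^-distribˡ-+-* r (k ∸ 2) 2) ⟨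
  N ^ k * r ^ (k ∸ 2 + 2)           ≡⟨ cong (λ e → N ^ k * r ^ e) (m∸n+n≡m 2≤k) ⟩
  N ^ k * r ^ k                     ≡⟨ *-comm (N ^ k) (r ^ k) ⟩
  r ^ k * N ^ k                     ≤⟨ bound ⟩
  k ^ k * (q * M)                   ≡⟨ swap (k ^ k) q M ⟩
  q * (k ^ k * M)                   ∎)
  where
  open ≤-Reasoning
  r q : ℕ
  r = suc s
  q = suc r
  regroup : ∀ q a b c → q * (a * b * c) ≡ a * (b * (q * c))
  regroup = solve-∀
  swap : ∀ a b c → a * (b * c) ≡ b * (a * c)
  swap = solve-∀
  square : ∀ x → 1 + (2 + x) * x ≡ (1 + x) * (1 + x)
  square = solve-∀
  q[q-2]≤[q-1]² : q * s ≤ r ^ 2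
  q[q-2]≤[q-1]² =
    ≤-trans (n≤1+n (q * s)) (≤-reflexive (trans (square s) (cong (r *_) (sym (*-identityʳ r)))))

module _ {b} {B : Set b} {N : ℕ} where

  ++-injective : ∀ {m n} {xs : Vector (Vector B N) m} {ys : Vector (Vector B N) n} →
    Injective _≡_ _≗_ xs → Injective _≡_ _≗_ ys → (∀ i j → ¬ xs i ≗ ys j) →
    Injective _≡_ _≗_ (xs ++ ys)
  ++-injective {m} {n} {xs} {ys} xs-inj ys-inj apart {i} {j} eq = begin
    i                       ≡⟨ join-splitAt m n i ⟨
    join m n (splitAt m i)  ≡⟨ cong (join m n) (halves (splitAt m i) (splitAt m j) eq) ⟩
    join m n (splitAt m j)  ≡⟨ join-splitAt m n j ⟩
    j                       ∎
    where
    open ≡-Reasoning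
    halves : ∀ u v → [ xs , ys ] u ≗ [ xs , ys ] v → u ≡ v
    halves (inj₁ i) (inj₁ j) e = cong inj₁ (xs-inj e)
    halves (inj₁ i) (inj₂ j) e = ⊥-elim (apart i j e)
    halves (inj₂ i) (inj₁ j) e = ⊥-elim (apart j i (sym ∘ e))
    halves (inj₂ i) (inj₂ j) e = cong inj₂ (ys-inj e)

  concat-injective : ∀ {m n} {xss : Vector (Vector (Vector B N) n) m} →
    (∀ {i j i′ j′} → xss i j ≗ xss i′ j′ → i ≡ i′ × j ≡ j′) →
    Injective _≡_ _≗_ (concat xss)
  concat-injective {m} {n} xss-inj {x} {y} eq = begin
    x                                ≡⟨ combine-remQuot {m} n x ⟨
    combine (quot x) (rem x)         ≡⟨ cong₂ combine (proj₁ same) (proj₂ same) ⟩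
    combine (quot y) (rem y)         ≡⟨ combine-remQuot {m} n y ⟩
    y                                ∎
    where
    open ≡-Reasoning
    quot : Fin (m * n) → Fin m
    quot z = proj₁ (remQuot {m} n z)
    rem : Fin (m * n) → Fin n
    rem z = proj₂ (remQuot {m} n z)
    same : quot x ≡ quot y × rem x ≡ rem y
    same = xss-inj eq

  concat⁺ : ∀ {p} (P : Vector B N → Set p) {m n} {xss : Vector (Vector (Vector B N) n) m} →
    (∀ i j → P (xss i j)) → ∀ x → P (concat xss x)
  concat⁺ P all-P x = all-P _ _

funToFin-injective : ∀ {m n} {f g : Fin m → Fin n} → funToFin f ≡ funToFin g → f ≗ g
funToFin-injective {f = f} {g} same i = begin
  f i                       ≡⟨ finToFun-funToFin f i ⟨
  finToFun (funToFin f) i   ≡⟨ cong (λ z → finToFun z i) same ⟩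
  finToFun (funToFin g) i   ≡⟨ finToFun-funToFin g i ⟩
  g i                       ∎
  where open ≡-Reasoning

-- An increasing choice of m of the indices 0,…,N-1.
data Choice : ℕ → ℕ → Set where
  none : Choice 0 0
  take : ∀ {m N} → Choice m N → Choice (suc m) (suc N)
  skip : ∀ {m N} → Choice m N → Choice m (suc N)

chosen : ∀ {m N} → Choice m N → Fin m → Fin N
chosen (take σ) zero    = zero
chosen (take σ) (suc i) = suc (chosen σ i)
chosen (skip σ) i       = suc (chosen σ i)

chosen-injective : ∀ {m N} (σ : Choice m N) → Injective _≡_ _≡_ (chosen σ)
chosen-injective (take σ) {zero}  {zero}  _  = refl
chosen-injective (take σ) {suc i} {suc j} eq = cong suc (chosen-injective σ (sucᶠ-injective eq))
chosen-injective (skip σ)                 eq = chosen-injective σ (sucᶠ-injective eq)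

everything : ∀ N → Choice N N
everything zero    = none
everything (suc N) = take (everything N)

module OverField {q : ℕ} (F : FieldOn q) where
  open FieldOn F renaming (_+_ to _⊕_; _*_ to _·_)

  fieldRing : CommutativeRing 0ℓ 0ℓ
  fieldRing = record { isCommutativeRing = isCommutativeRing }

  open CommutativeRing fieldRing
    using (+-identityˡ; zeroˡ; +-abelianGroup; +-monoid; semiring; ring) renaming (_-_ to _⊖_)
  open SemiringSum semiring using (sum; sum-cong-≗; ∑-distrib-+)
  open MonoidMult +-monoid using () renaming (_×_ to _×ᶠ_)
  open RingProperties ring using ([y-z]x≈yx-zx)
  open AbelianGroupProperties +-abelianGroup
    using (//-rightDividesˡ; identityˡ-unique; x∙y⁻¹≈ε⇒x≈y; x≈y⇒x∙y⁻¹≈ε)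

  ∑≡sum : ∀ {N} (f : Vector (Fin q) N) → ∑ F f ≡ sum f
  ∑≡sum {zero}  f = refl
  ∑≡sum {suc N} f = cong (f zero ⊕_) (∑≡sum (f ∘ suc))

  ∑-cong : ∀ {N} {f g : Vector (Fin q) N} → f ≗ g → ∑ F f ≡ ∑ F g
  ∑-cong {f = f} {g} f≗g = trans (∑≡sum f) (trans (sum-cong-≗ f≗g) (sym (∑≡sum g)))

  ∑-sub-vanishes : ∀ {N} (v w : Vector (Fin q) N) → ∑ F v ≡ ∑ F w → ∑ F (λ j → v j ⊖ w j) ≡ 0#
  ∑-sub-vanishes v w ∑v≡∑w = identityˡ-unique (∑ F d) (∑ F w) (begin
    ∑ F d ⊕ ∑ F w                ≡⟨ cong₂ _⊕_ (∑≡sum d) (∑≡sum w) ⟩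
    sum d ⊕ sum w                ≡⟨ ∑-distrib-+ d w ⟨
    sum (λ j → d j ⊕ w j)        ≡⟨ sum-cong-≗ (λ j → //-rightDividesˡ (w j) (v j)) ⟩
    sum v                        ≡⟨ ∑≡sum v ⟨
    ∑ F v                        ≡⟨ ∑v≡∑w ⟩
    ∑ F w                        ∎)
    where
    open ≡-Reasoning
    d : Vector (Fin q) _
    d j = v j ⊖ w j

  ∑-sub-vanishes-weighted : ∀ {N} (v w x : Vector (Fin q) N) →
    ∑ F (λ j → v j · x j) ≡ ∑ F (λ j → w j · x j) → ∑ F (λ j → (v j ⊖ w j) · x j) ≡ 0#
  ∑-sub-vanishes-weighted v w x eq =
    trans (∑-cong (λ j → [y-z]x≈yx-zx (x j) (v j) (w j)))
          (∑-sub-vanishes (λ j → v j · x j) (λ j → w j · x j) eq)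

  nonzero? : Fin q → ℕ
  nonzero? x = if does (x ≟ᶠ 0#) then 0 else 1

  weight : ∀ {N} → Vector (Fin q) N → ℕ
  weight {zero}  v = 0
  weight {suc N} v = nonzero? (v zero) + weight (v ∘ suc)

  nonzero?-0# : nonzero? 0# ≡ 0
  nonzero?-0# with 0# ≟ᶠ 0#
  ... | yes _ = refl
  ... | no 0≢0 = ⊥-elim (0≢0 refl)

  nonzero?≤1 : ∀ x → nonzero? x ≤ 1
  nonzero?≤1 x with x ≟ᶠ 0#
  ... | yes _ = z≤n
  ... | no _  = s≤s z≤n

  nonzero?-covered : ∀ x y z → (x ≡ 0# → y ≡ 0# → z ≡ 0#) → nonzero? z ≤ nonzero? x + nonzero? y
  nonzero?-covered x y z covered with z ≟ᶠ 0# | x ≟ᶠ 0# | y ≟ᶠ 0#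
  ... | yes _  | _      | _      = z≤n
  ... | no z≢0 | yes x≡0 | yes y≡0 = ⊥-elim (z≢0 (covered x≡0 y≡0))
  ... | no _   | no _   | _      = s≤s z≤n
  ... | no _   | yes _  | no _   = s≤s z≤n

  weight-covered : ∀ {N} (v w d : Vector (Fin q) N) → (∀ j → v j ≡ 0# → w j ≡ 0# → d j ≡ 0#) →
    weight d ≤ weight v + weight w
  weight-covered {zero}  v w d covered = z≤n
  weight-covered {suc N} v w d covered = begin
    nonzero? (d zero) + weight (d ∘ suc)
      ≤⟨ +-mono-≤ (nonzero?-covered (v zero) (w zero) (d zero) (covered zero))
                    (weight-covered (v ∘ suc) (w ∘ suc) (d ∘ suc) (covered ∘ suc)) ⟩
    (nonzero? (v zero) + nonzero? (w zero)) + (weight (v ∘ suc) + weight (w ∘ suc))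
      ≡⟨ interchange (nonzero? (v zero)) (nonzero? (w zero)) (weight (v ∘ suc)) (weight (w ∘ suc)) ⟩
    weight v + weight w ∎
    where
    open ≤-Reasoning
    interchange : ∀ a b c d → (a + b) + (c + d) ≡ (a + c) + (b + d)
    interchange = solve-∀

  weight-0∷ : ∀ {N} (v : Vector (Fin q) N) → weight (0# ∷ v) ≡ weight v
  weight-0∷ v = cong (_+ weight v) nonzero?-0#

  weight-∷ : ∀ {N} c (v : Vector (Fin q) N) → weight (c ∷ v) ≤ suc (weight v)
  weight-∷ c v = +-monoˡ-≤ (weight v) (nonzero?≤1 c)

  VanishesOff : ∀ {m N} → Choice m N → Vector (Fin q) N → Set
  VanishesOff none     d = ⊤
  VanishesOff (take σ) d = VanishesOff σ (d ∘ suc)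
  VanishesOff (skip σ) d = d zero ≡ 0# × VanishesOff σ (d ∘ suc)

  vanishesOff-everything : ∀ N (d : Vector (Fin q) N) → VanishesOff (everything N) d
  vanishesOff-everything zero    d = tt
  vanishesOff-everything (suc N) d = vanishesOff-everything N (d ∘ suc)

  -- Any vector of weight at most m ≤ N vanishes off some choice of m indices:
  -- index 0 is taken if d₀ ≠ 0 or if all remaining indices are needed,
  -- and skipped otherwise.
  cover : ∀ {N m} (d : Vector (Fin q) N) → weight d ≤ m → m ≤ N →
    Σ (Choice m N) λ σ → VanishesOff σ d
  cover {zero}  {zero} d _ _ = none , tt
  cover {suc N} {m}    d weight≤m m≤1+N with d zero ≟ᶠ 0# | m ≤? N
  ... | yes d₀≡0 | yes m≤N =
    let (σ , off) = cover (d ∘ suc) weight≤m m≤N in skip σ , d₀≡0 , off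
  ... | yes d₀≡0 | no m≰N rewrite ≤-antisym m≤1+N (≰⇒> m≰N) =
    everything (suc N) , vanishesOff-everything (suc N) d
  ... | no d₀≢0  | _ with m | weight≤m | m≤1+N
  ...   | suc m | s≤s weight≤m | s≤s m≤N =
    let (σ , off) = cover (d ∘ suc) weight≤m m≤N in take σ , off

  ∑-restrict : ∀ {m N} (σ : Choice m N) (d : Vector (Fin q) N) → VanishesOff σ d →
    ∑ F d ≡ ∑ F (d ∘ chosen σ)
  ∑-restrict none     d _            = refl
  ∑-restrict (take σ) d off          = cong (d zero ⊕_) (∑-restrict σ (d ∘ suc) off)
  ∑-restrict (skip σ) d (d₀≡0 , off) = begin
    d zero ⊕ ∑ F (d ∘ suc)     ≡⟨ cong (_⊕ ∑ F (d ∘ suc)) d₀≡0 ⟩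
    0# ⊕ ∑ F (d ∘ suc)         ≡⟨ +-identityˡ _ ⟩
    ∑ F (d ∘ suc)              ≡⟨ ∑-restrict σ (d ∘ suc) off ⟩
    ∑ F (d ∘ chosen (skip σ))  ∎
    where open ≡-Reasoning

  vanishesOff-scale : ∀ {m N} (σ : Choice m N) (d x : Vector (Fin q) N) → VanishesOff σ d →
    VanishesOff σ (λ j → d j · x j)
  vanishesOff-scale none     d x _            = tt
  vanishesOff-scale (take σ) d x off          = vanishesOff-scale σ (d ∘ suc) (x ∘ suc) off
  vanishesOff-scale (skip σ) d x (d₀≡0 , off) =
    trans (cong (_· x zero) d₀≡0) (zeroˡ (x zero)) , vanishesOff-scale σ (d ∘ suc) (x ∘ suc) off

  vanishesOff-zero : ∀ {m N} (σ : Choice m N) (d : Vector (Fin q) N) → VanishesOff σ d →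
    (∀ i → d (chosen σ i) ≡ 0#) → ∀ j → d j ≡ 0#
  vanishesOff-zero (take σ) d off on zero    = on zero
  vanishesOff-zero (take σ) d off on (suc j) = vanishesOff-zero σ (d ∘ suc) off (on ∘ suc) j
  vanishesOff-zero (skip σ) d (d₀≡0 , off) on zero    = d₀≡0
  vanishesOff-zero (skip σ) d (d₀≡0 , off) on (suc j) = vanishesOff-zero σ (d ∘ suc) off on j

  module Rows {r} (ν : Fin r → Fin q) where

    prefixByν : ∀ {N M} → Vector (Vector (Fin q) N) M → Vector (Vector (Vector (Fin q) (suc N)) M) r
    prefixByν table c = map (ν c ∷_) table

    rows : ∀ N k → Vector (Vector (Fin q) N) (weightCount r N k)
    rows zero    zero    = λ _ ()
    rows zero    (suc k) = λ ()
    rows (suc N) zero    = map (0# ∷_) (rows N zero)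
    rows (suc N) (suc k) = map (0# ∷_) (rows N (suc k)) ++ concat (prefixByν (rows N k))

    rows-weight : ∀ N k x → weight (rows N k x) ≤ k
    rows-weight zero    zero    x = z≤n
    rows-weight (suc N) zero    x = ≤-trans (≤-reflexive (weight-0∷ (rows N zero x))) (rows-weight N zero x)
    rows-weight (suc N) (suc k)   = ++⁺ (λ v → weight v ≤ suc k) {ys = concat (prefixByν (rows N k))}
      (λ x → ≤-trans (≤-reflexive (weight-0∷ (rows N (suc k) x))) (rows-weight N (suc k) x))
      (concat⁺ (λ v → weight v ≤ suc k) {xss = prefixByν (rows N k)}
        λ c x → ≤-trans (weight-∷ (ν c) (rows N k x)) (s≤s (rows-weight N k x)))

    rows-injective : (∀ c → ¬ ν c ≡ 0#) → Injective _≡_ _≡_ ν → ∀ N k → Injective _≡_ _≗_ (rows N k)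
    rows-injective ν≢0 ν-inj zero    zero    {zero} {zero} _ = refl
    rows-injective ν≢0 ν-inj (suc N) zero    same = rows-injective ν≢0 ν-inj N zero (same ∘ suc)
    rows-injective ν≢0 ν-inj (suc N) (suc k) = ++-injective
      (λ same → rows-injective ν≢0 ν-inj N (suc k) (same ∘ suc))
      (concat-injective {xss = prefixByν (rows N k)}
        λ same → ν-inj (same zero) , rows-injective ν≢0 ν-inj N k (same ∘ suc))
      (λ _ _ same → ν≢0 _ (sym (same zero)))

    rows-sum : (∀ c → ν c ≡ 1#) → ∀ N k x → ∑ F (rows N k x) ≡ k ×ᶠ 1#
    rows-sum ν≡1 zero    zero    x = refl
    rows-sum ν≡1 (suc N) zero    x = trans (+-identityˡ _) (rows-sum ν≡1 N zero x)
    rows-sum ν≡1 (suc N) (suc k)   = ++⁺ (λ v → ∑ F v ≡ suc k ×ᶠ 1#) {ys = concat (prefixByν (rows N k))}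
      (λ x → trans (+-identityˡ _) (rows-sum ν≡1 N (suc k) x))
      (concat⁺ (λ v → ∑ F v ≡ suc k ×ᶠ 1#) {xss = prefixByν (rows N k)}
        λ c x → cong₂ _⊕_ (ν≡1 c) (rows-sum ν≡1 N k x))

  syndrome : ∀ {n N} → (Fin N → Point q n) → Vector (Fin q) N → Vector (Fin q) (suc n)
  syndrome a d = ∑ F d ∷ λ i → ∑ F (λ j → d j · a j i)

  module _ {n N m} (a : Fin N → Point q n) (general : IsGeneral F m a) where

    -- m-generality: a nonzero vector of weight ≤ m never has syndrome zero,
    -- since its support fits in some m points, which are affinely independent.
    light-syndrome-zero : ∀ d → weight d ≤ m → syndrome a d ≗ (λ _ → 0#) → ∀ j → d j ≡ 0#
    light-syndrome-zero d weight≤m zero-syndrome =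
      vanishesOff-zero σ d off (proj₂ general (chosen σ) (chosen-injective σ) (d ∘ chosen σ)
        (trans (sym (∑-restrict σ d off)) (zero-syndrome zero))
        (λ i → trans (sym (∑-restrict σ (λ j → d j · a j i) (vanishesOff-scale σ d (λ j → a j i) off)))
                     (zero-syndrome (suc i))))
      where
      σ : Choice m N
      σ = proj₁ (cover d weight≤m (proj₁ general))
      off : VanishesOff σ d
      off = proj₂ (cover d weight≤m (proj₁ general))

    syndrome-injective : ∀ {k} (v w : Vector (Fin q) N) → weight v ≤ k → weight w ≤ k → k + k ≤ m →
      syndrome a v ≗ syndrome a w → v ≗ w
    syndrome-injective {k} v w weight-v weight-w 2k≤m same j =
      x∙y⁻¹≈ε⇒x≈y (v j) (w j) (light-syndrome-zero d weight-d difference-zero j)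
      where
      d : Vector (Fin q) N
      d j = v j ⊖ w j
      weight-d : weight d ≤ m
      weight-d = ≤-trans (weight-covered v w d λ j v≡0 w≡0 → x≈y⇒x∙y⁻¹≈ε (trans v≡0 (sym w≡0)))
                         (≤-trans (+-mono-≤ weight-v weight-w) 2k≤m)
      difference-zero : syndrome a d ≗ (λ _ → 0#)
      difference-zero zero    = ∑-sub-vanishes v w (same zero)
      difference-zero (suc i) = ∑-sub-vanishes-weighted v w (λ j → a j i) (same (suc i))

    count-syndromes : ∀ {k r} (ν : Fin r → Fin q) → (∀ c → ¬ ν c ≡ 0#) → Injective _≡_ _≡_ ν →
      k + k ≤ m → weightCount r N k ≤ q ^ suc n
    count-syndromes {k} ν ν≢0 ν-inj 2k≤m = injective⇒≤ {f = funToFin ∘ syndrome a ∘ rows N k}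
      λ same → rows-injective ν≢0 ν-inj N k
        (syndrome-injective (rows N k _) (rows N k _) (rows-weight N k _) (rows-weight N k _) 2k≤m
          (funToFin-injective same))
      where open Rows ν

    -- The k-subsets all have first syndrome coordinate k·1, so their
    -- number C(N,k) is at most q^n.
    count-subsets : ∀ {k} → k + k ≤ m → weightCount 1 N k ≤ q ^ n
    count-subsets {k} 2k≤m = injective⇒≤ {f = funToFin ∘ tail ∘ syndrome a ∘ rows N k}
      λ {x} {y} same → rows-injective (λ _ 1≡0 → 0≢1 (sym 1≡0)) one-injective N k
        (syndrome-injective (rows N k x) (rows N k y) (rows-weight N k x) (rows-weight N k y) 2k≤m
          λ { zero → trans (rows-sum (λ _ → refl) N k x) (sym (rows-sum (λ _ → refl) N k y))
            ; (suc i) → funToFin-injective same i })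
      where
      open Rows {1} (λ _ → 1#)
      one-injective : Injective _≡_ _≡_ (λ (_ : Fin 1) → 1#)
      one-injective {zero} {zero} _ = refl

large-field-bound : ∀ {q n N m k} (F : FieldOn q) (a : Fin N → Point q n) → IsGeneral F m a →
  k + k ≤ m → 2 ≤ k → k ≤ N → 2 ≤ q → N ^ k * (q ∸ 1) ^ (k ∸ 2) * (q ∸ 2) ≤ k ^ k * q ^ n
large-field-bound {suc (suc s)} {n} {N} {m} {k} F a general 2k≤m 2≤k k≤N (s≤s (s≤s z≤n)) =
  trade-q-for-q-2 s N k (suc (suc s) ^ n) 2≤k
    (count⇒scaledBound (suc s) N k (suc (suc s) ^ suc n) k≤N
      (count-syndromes a general {k} (punchIn zeroᶠ) (punchInᵢ≢i zeroᶠ)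
        (punchIn-injective zeroᶠ _ _) 2k≤m))
  where
  open OverField F
  -- The q - 1 nonzero values are listed by punchIn zeroᶠ, which skips zero.
  zeroᶠ : Fin (suc (suc s))
  zeroᶠ = FieldOn.0# F

subset-bound : ∀ {q n N m k} (F : FieldOn q) (a : Fin N → Point q n) → IsGeneral F m a →
  k + k ≤ m → (N ∸ k) ^ k ≤ k ! * q ^ n
subset-bound {q} {n} {N} {m} {k} F a general 2k≤m = begin
  (N ∸ k) ^ k           ≡⟨ *-identityˡ ((N ∸ k) ^ k) ⟨
  1 * (N ∸ k) ^ k       ≡⟨ cong (_* (N ∸ k) ^ k) (^-zeroˡ k) ⟨
  1 ^ k * (N ∸ k) ^ k   ≤⟨ count⇒shiftedBound 1 N k (q ^ n) (count-subsets a general {k} 2k≤m) ⟩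
  k ! * q ^ n           ∎
  where
  open ≤-Reasoning
  open OverField F

theorem3p1 : (m q n : ℕ) → 4 ≤ m → IsPrimePower q → 1 ≤ n → m ≤ n + 2 →
    (F : FieldOn q) → (N : ℕ) → (a : Fin N → Point q n) → Injective _≡_ _≡_ a →
    IsGeneral F m a →
    (2 < q → (N ^ (m / 2)) * ((q ∸ 1) ^ ((m / 2) ∸ 2)) * (q ∸ 2) ≤ ((m / 2) ^ (m / 2)) * (q ^ n))
    × (q ≡ 2 → (N ∸ (m / 2)) ^ (m / 2) ≤ ((m / 2) !) * (2 ^ n))
theorem3p1 m q n 4≤m _ _ _ F N a _ general =
  (λ 2<q → large-field-bound F a general 2k≤m 2≤k k≤N (<⇒≤ 2<q)) ,
  (λ { refl → subset-bound {k = k} F a general 2k≤m })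
  where
  k : ℕ
  k = m / 2
  2k≤m : k + k ≤ m
  2k≤m = ≤-trans (≤-reflexive (trans (cong (k +_) (sym (+-identityʳ k))) (*-comm 2 k))) (m/n*n≤m m 2)
  2≤k : 2 ≤ k
  2≤k = /-monoˡ-≤ 2 4≤m
  k≤N : k ≤ N
  k≤N = ≤-trans (m≤m+n k k) (≤-trans 2k≤m (proj₁ general))
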